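{- Let $\lambda$ be a positive integer. Every $(\lambda+1,\lambda)$-liking digraph is a two-way $(\lambda+1,\lambda)$-liking digraph.
   Context: All digraphs are finite, with no loops and no multiple arcs. For positive integers $t$ and $\lambda$, a digraph is a $(t,\lambda)$-liking digraph if every set of $t$ distinct vertices has exactly $\lambda$ common out-neighbors, and it is a two-way $(t,\lambda)$-liking digraph if every set of $t$ distinct vertices has exactly $\lambda$ common out-neighbors and exactly $\lambda$ common in-neighbors. -}

module Defs where

open import Data.Nat using (ℕ)
open import Data.Bool using (Bool; true; false)
open import Data.Bool.Properties using () renaming (_≟_ to _≟ᵇ_)
open import Data.Fin using (Fin)
open import Data.Fin.Properties using (all?)
open import Data.Fin.Subset using (Subset; _∈_; ∣_∣)
open import Data.Fin.Subset.Properties using (_∈?_)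
open import Data.Vec using (tabulate)
open import Relation.Binary.PropositionalEquality using (_≡_)
open import Relation.Nullary using (Dec; yes; no)
open import Relation.Nullary.Decidable using (⌊_⌋; _→-dec_)

record Digraph (n : ℕ) : Set where
  field
    arc      : Fin n → Fin n → Bool
    loopless : ∀ v → arc v v ≡ false

open Digraph public

converse : ∀ {n} → Digraph n → Digraph n
converse G = record { arc = λ u v → arc G v u ; loopless = loopless G }

commonOut : ∀ {n} → Digraph n → Subset n → Subset n
commonOut G S = tabulate λ w → ⌊ all? (λ v → (v ∈? S) →-dec (arc G v w ≟ᵇ true)) ⌋

commonIn : ∀ {n} → Digraph n → Subset n → Subset n
commonIn G S = tabulate λ w → ⌊ all? (λ v → (v ∈? S) →-dec (arc G w v ≟ᵇ true)) ⌋

IsLiking : ∀ {n} → ℕ → ℕ → Digraph n → Set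
IsLiking t l G = ∀ (S : Subset _) → ∣ S ∣ ≡ t → ∣ commonOut G S ∣ ≡ l

IsTwoWayLiking : ∀ {n} → ℕ → ℕ → Digraph n → Set
IsTwoWayLiking t l G =
  ∀ (S : Subset _) → ∣ S ∣ ≡ t → (∣ commonOut G S ∣ ≡ l) × (∣ commonIn G S ∣ ≡ l)
  where open import Data.Product using (_×_)

{-# OPTIONS --safe #-}

-- Liking bounds common in-neighbourhoods: if a (λ+1)-set W had λ+1 common
-- in-neighbours U, then W would lie among the λ common out-neighbours of U. Now fix a vertex w
-- and count pairs (Q, Z) of λ-sets with Q → w → Z and every arc from Q to Z. Each λ-set Q of
-- in-neighbours of w has exactly one partner, the λ common out-neighbours of Q ∪ {w}, and each
-- λ-set Z of out-neighbours has at most one, the common in-neighbourhood of Z ∪ {w}. Hence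
-- C(d⁻(w), λ) ≤ C(d⁺(w), λ), and as λ ≥ 1 the same holds with λ+1 in place of λ. Summing over w,
-- the (λ+1)-sets have in total at least as many common in- as out-neighbours; since every
-- (λ+1)-set has exactly λ common out-neighbours and at most λ common in-neighbours, every bound
-- is attained.

module Submission where

open import Defs
open import Data.Nat using (ℕ; zero; suc; NonZero; _+_; _*_; _≤_; _<_; z≤n; s≤s; _≟_)
open import Data.Nat.Properties
open import Data.Nat.Combinatorics using (_C_; nCn≡1; k>n⇒nCk≡0; nCk+nC[k+1]≡[n+1]C[k+1])
open import Data.Bool using (Bool; true; if_then_else_)
open import Data.Fin using (Fin; zero; suc)
open import Data.Fin.Subset
  using (Subset; outside; inside; _∈_; _∉_; _⊆_; ∣_∣; _∪_; ⁅_⁆) renaming (⊥ to ∅)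
open import Data.Fin.Subset.Properties
  using ( _∈?_; _⊆?_; out⊆; s⊆s; ∉⊥; ∣⊥∣≡0; ∪-identityʳ; p⊆q⇒∣p∣≤∣q∣
        ; x∈p∪q⁻; x∈p∪q⁺; x∈⁅x⁆; x∈⁅y⁆⇒x≡y)
open import Data.Vec using ([]; _∷_; tabulate; here; there)
open import Data.Vec.Properties using (lookup∘tabulate; []=⇒lookup; lookup⇒[]=)
open import Data.Product using (_×_; _,_; ∃-syntax)
open import Data.Sum using (inj₁; inj₂; [_,_])
open import Function using (_∘_; _⇔_; mk⇔; Equivalence; case_of_)
open import Relation.Binary.PropositionalEquality
  using (_≡_; refl; sym; trans; cong; cong₂; subst; module ≡-Reasoning)
open import Relation.Nullary using (¬_; contradiction)
open import Relation.Nullary.Decidable using (Dec; does; ⌊_⌋; yes; no; _×-dec_; does-⇔; dec-false)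
open import Algebra.Properties.Semiring.Sum +-*-semiring
  using (sum; sum-syntax; sum-cong-≗; ∑-distrib-+; *-distribˡ-sum)
open import Algebra.Properties.CommutativeSemigroup +-commutativeSemigroup using (interchange)
open import Function.Properties.Equivalence using () renaming (sym to ⇔-sym; trans to ⇔-trans)

open Equivalence using (to; from)

private
  variable
    n m k l t : ℕ
    A B : Set
    G : Digraph n
    w : Fin n

𝟙 : Dec A → ℕ
𝟙 p = if does p then 1 else 0

𝟙-cong : A ⇔ B → (p : Dec A) (q : Dec B) → 𝟙 p ≡ 𝟙 q
𝟙-cong A⇔B p q = cong (λ b → if b then 1 else 0) (does-⇔ A⇔B p q)

𝟙-no : (p : Dec A) → ¬ A → 𝟙 p ≡ 0
𝟙-no p ¬p = cong (λ b → if b then 1 else 0) (dec-false p ¬p)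

𝟙-× : (p : Dec A) (q : Dec B) → 𝟙 (p ×-dec q) ≡ 𝟙 p * 𝟙 q
𝟙-× (yes _) q = sym (+-identityʳ (𝟙 q))
𝟙-× (no _)  q = refl

𝟙*-cong : ∀ {x y} (p : Dec A) → (A → x ≡ y) → 𝟙 p * x ≡ 𝟙 p * y
𝟙*-cong (yes a) h = cong (1 *_) (h a)
𝟙*-cong (no _)  h = refl

𝟙*-mono-≤ : ∀ {x y} (p : Dec A) → (A → x ≤ y) → 𝟙 p * x ≤ 𝟙 p * y
𝟙*-mono-≤ (yes a) h = *-monoʳ-≤ 1 (h a)
𝟙*-mono-≤ (no _)  h = z≤n

𝟙*-cancel : ∀ {x y} (p : Dec A) → A → 𝟙 p * x ≡ 𝟙 p * y → x ≡ y
𝟙*-cancel (yes _) _ e = *-cancelˡ-≡ _ _ 1 e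
𝟙*-cancel (no ¬a) a _ = contradiction a ¬a

∑ˢ : (Subset n → ℕ) → ℕ
∑ˢ {zero}  f = f []
∑ˢ {suc n} f = ∑ˢ (f ∘ (outside ∷_)) + ∑ˢ (f ∘ (inside ∷_))

infixl 10 ∑ˢ
syntax ∑ˢ (λ U → e) = ∑ˢ[ U ] e

∑ˢ-cong : {f g : Subset n → ℕ} → (∀ U → f U ≡ g U) → ∑ˢ f ≡ ∑ˢ g
∑ˢ-cong {zero}  h = h []
∑ˢ-cong {suc n} h = cong₂ _+_ (∑ˢ-cong (h ∘ (outside ∷_))) (∑ˢ-cong (h ∘ (inside ∷_)))

∑ˢ-mono-≤ : {f g : Subset n → ℕ} → (∀ U → f U ≤ g U) → ∑ˢ f ≤ ∑ˢ g
∑ˢ-mono-≤ {zero}  h = h []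
∑ˢ-mono-≤ {suc n} h = +-mono-≤ (∑ˢ-mono-≤ (h ∘ (outside ∷_))) (∑ˢ-mono-≤ (h ∘ (inside ∷_)))

∑ˢ-zero : ∑ˢ {n} (λ _ → 0) ≡ 0
∑ˢ-zero {zero}  = refl
∑ˢ-zero {suc n} = cong₂ _+_ (∑ˢ-zero {n}) (∑ˢ-zero {n})

∑ˢ-distrib-+ : (f g : Subset n → ℕ) → ∑ˢ[ U ] (f U + g U) ≡ ∑ˢ f + ∑ˢ g
∑ˢ-distrib-+ {zero}  f g = refl
∑ˢ-distrib-+ {suc n} f g = begin
  ∑ˢ[ U ] (f (outside ∷ U) + g (outside ∷ U)) + ∑ˢ[ U ] (f (inside ∷ U) + g (inside ∷ U))
    ≡⟨ cong₂ _+_ (∑ˢ-distrib-+ (f ∘ (outside ∷_)) (g ∘ (outside ∷_)))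
                 (∑ˢ-distrib-+ (f ∘ (inside ∷_)) (g ∘ (inside ∷_))) ⟩
  (∑ˢ (f ∘ (outside ∷_)) + ∑ˢ (g ∘ (outside ∷_))) + (∑ˢ (f ∘ (inside ∷_)) + ∑ˢ (g ∘ (inside ∷_)))
    ≡⟨ interchange (∑ˢ (f ∘ (outside ∷_))) _ _ _ ⟩
  ∑ˢ f + ∑ˢ g ∎
  where open ≡-Reasoning

*-distribˡ-∑ˢ : ∀ x (f : Subset n → ℕ) → x * ∑ˢ f ≡ ∑ˢ[ U ] (x * f U)
*-distribˡ-∑ˢ {zero}  x f = refl
*-distribˡ-∑ˢ {suc n} x f =
  trans (*-distribˡ-+ x _ _)
        (cong₂ _+_ (*-distribˡ-∑ˢ x (f ∘ (outside ∷_))) (*-distribˡ-∑ˢ x (f ∘ (inside ∷_))))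

∑ˢ-comm : (F : Subset m → Subset n → ℕ) → ∑ˢ[ Q ] ∑ˢ (F Q) ≡ ∑ˢ[ Z ] ∑ˢ[ Q ] F Q Z
∑ˢ-comm {zero}  F = refl
∑ˢ-comm {suc m} F = trans (cong₂ _+_ (∑ˢ-comm (F ∘ (outside ∷_))) (∑ˢ-comm (F ∘ (inside ∷_))))
  (sym (∑ˢ-distrib-+ (λ Z → ∑ˢ[ Q ] F (outside ∷ Q) Z) (λ Z → ∑ˢ[ Q ] F (inside ∷ Q) Z)))

∑ˢ-∑-comm : (F : Subset m → Fin n → ℕ) → ∑ˢ[ U ] ∑[ w < n ] F U w ≡ ∑[ w < n ] ∑ˢ[ U ] F U w
∑ˢ-∑-comm {zero}  F = refl
∑ˢ-∑-comm {suc m} F = trans (cong₂ _+_ (∑ˢ-∑-comm (F ∘ (outside ∷_))) (∑ˢ-∑-comm (F ∘ (inside ∷_))))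
  (sym (∑-distrib-+ (λ w → ∑ˢ[ U ] F (outside ∷ U) w) (λ w → ∑ˢ[ U ] F (inside ∷ U) w)))

∑-mono-≤ : (f g : Fin n → ℕ) → (∀ i → f i ≤ g i) → sum f ≤ sum g
∑-mono-≤ {zero}  f g h = z≤n
∑-mono-≤ {suc n} f g h = +-mono-≤ (h zero) (∑-mono-≤ (f ∘ suc) (g ∘ suc) (h ∘ suc))

∑ˢ-squeeze : {f g : Subset n → ℕ} → (∀ U → f U ≤ g U) → ∑ˢ g ≤ ∑ˢ f → ∀ U → f U ≡ g U
∑ˢ-squeeze {zero}  f≤g g≤f [] = ≤-antisym (f≤g []) g≤f
∑ˢ-squeeze {suc n} {f} {g} f≤g g≤f (outside ∷ U) =
  ∑ˢ-squeeze (f≤g ∘ (outside ∷_))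
    (+-cancelʳ-≤ _ _ _ (≤-trans g≤f (+-monoʳ-≤ _ (∑ˢ-mono-≤ (f≤g ∘ (inside ∷_)))))) U
∑ˢ-squeeze {suc n} {f} {g} f≤g g≤f (inside ∷ U) =
  ∑ˢ-squeeze (f≤g ∘ (inside ∷_))
    (+-cancelˡ-≤ _ _ _ (≤-trans g≤f (+-monoˡ-≤ _ (∑ˢ-mono-≤ (f≤g ∘ (outside ∷_)))))) U

_⊆[_]_ : Subset n → ℕ → Subset n → Set
U ⊆[ m ] S = U ⊆ S × ∣ U ∣ ≡ m

_⊆[_]?_ : (U : Subset n) (m : ℕ) (S : Subset n) → Dec (U ⊆[ m ] S)
U ⊆[ m ]? S = U ⊆? S ×-dec ∣ U ∣ ≟ m

∑ˢ-𝟙-⊆[]≡C : ∀ m (S : Subset n) → ∑ˢ[ U ] 𝟙 (U ⊆[ m ]? S) ≡ ∣ S ∣ C m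
∑ˢ-𝟙-⊆[]≡C zero    []            = refl
∑ˢ-𝟙-⊆[]≡C (suc m) []            = refl
∑ˢ-𝟙-⊆[]≡C {suc n} m (outside ∷ S) =
  trans (cong₂ _+_ (∑ˢ-𝟙-⊆[]≡C m S) (∑ˢ-zero {n})) (+-identityʳ (∣ S ∣ C m))
∑ˢ-𝟙-⊆[]≡C {suc n} zero (inside ∷ S) =
  cong₂ _+_ (∑ˢ-𝟙-⊆[]≡C zero S)
    (trans (∑ˢ-cong (λ U → 𝟙-no ((inside ∷ U) ⊆[ 0 ]? (inside ∷ S)) λ ())) (∑ˢ-zero {n}))
∑ˢ-𝟙-⊆[]≡C (suc m) (inside ∷ S) = begin
  ∑ˢ[ U ] 𝟙 (U ⊆[ suc m ]? S) + ∑ˢ[ U ] 𝟙 (U ⊆[ m ]? S)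
    ≡⟨ cong₂ _+_ (∑ˢ-𝟙-⊆[]≡C (suc m) S) (∑ˢ-𝟙-⊆[]≡C m S) ⟩
  ∣ S ∣ C suc m + ∣ S ∣ C m
    ≡⟨ +-comm (∣ S ∣ C suc m) _ ⟩
  ∣ S ∣ C m + ∣ S ∣ C suc m
    ≡⟨ nCk+nC[k+1]≡[n+1]C[k+1] ∣ S ∣ m ⟩
  suc ∣ S ∣ C suc m ∎
  where open ≡-Reasoning

nCk≤[1+n]Ck : ∀ n k → n C k ≤ suc n C k
nCk≤[1+n]Ck n zero    = ≤-refl
nCk≤[1+n]Ck n (suc k) = begin
  n C suc k             ≤⟨ m≤n+m _ (n C k) ⟩
  n C k + n C suc k     ≡⟨ nCk+nC[k+1]≡[n+1]C[k+1] n k ⟩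
  suc n C suc k         ∎
  where open ≤-Reasoning

C-monoˡ-≤ : ∀ k → m ≤ n → m C k ≤ n C k
C-monoˡ-≤ {n = zero}  k z≤n = ≤-refl
C-monoˡ-≤ {n = suc n} k m≤1+n with m≤n⇒m<n∨m≡n m≤1+n
... | inj₁ (s≤s m≤n) = ≤-trans (C-monoˡ-≤ k m≤n) (nCk≤[1+n]Ck n k)
... | inj₂ refl      = ≤-refl

nCk>0 : k ≤ n → 0 < n C k
nCk>0 {zero}              _         = s≤s z≤n
nCk>0 {suc k} {suc n} (s≤s k≤n) = begin-strict
  0                     <⟨ nCk>0 k≤n ⟩
  n C k                 ≤⟨ m≤m+n _ _ ⟩
  n C k + n C suc k     ≡⟨ nCk+nC[k+1]≡[n+1]C[k+1] n k ⟩
  suc n C suc k         ∎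
  where open ≤-Reasoning

C-monoˡ-< : ∀ k → m < n → suc k ≤ n → m C suc k < n C suc k
C-monoˡ-< {m} {suc n} k (s≤s m≤n) (s≤s k≤n) = begin-strict
  m C suc k             <⟨ +-monoˡ-≤ _ (nCk>0 k≤n) ⟩
  n C k + m C suc k     ≤⟨ +-monoʳ-≤ (n C k) (C-monoˡ-≤ (suc k) m≤n) ⟩
  n C k + n C suc k     ≡⟨ nCk+nC[k+1]≡[n+1]C[k+1] n k ⟩
  suc n C suc k         ∎
  where open ≤-Reasoning

n≤k⇒nCk≤1 : n ≤ k → n C k ≤ 1
n≤k⇒nCk≤1 {n = n} n≤k with m≤n⇒m<n∨m≡n n≤k
... | inj₁ n<k  = ≤-trans (≤-reflexive (k>n⇒nCk≡0 n<k)) z≤n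
... | inj₂ refl = ≤-reflexive (nCn≡1 n)

-- m C (1+k) is strictly increasing in m ≥ k; this fails for m C 0, which is why λ ≥ 1 is needed.
mC[1+k]≤nC[1+k]⇒mC[2+k]≤nC[2+k] : ∀ m n k →
  m C suc k ≤ n C suc k → m C suc (suc k) ≤ n C suc (suc k)
mC[1+k]≤nC[1+k]⇒mC[2+k]≤nC[2+k] m n k mC≤nC with m ≤? suc k
... | yes m≤1+k = ≤-trans (≤-reflexive (k>n⇒nCk≡0 (s≤s m≤1+k))) z≤n
... | no  m≰1+k = C-monoˡ-≤ (suc (suc k)) m≤n
  where
  m≤n : m ≤ n
  m≤n = ≮⇒≥ λ n<m → <⇒≱ (C-monoˡ-< k n<m (<⇒≤ (≰⇒> m≰1+k))) mC≤nC

∣p∣≡∑𝟙∈ : (p : Subset n) → ∣ p ∣ ≡ ∑[ x < n ] 𝟙 (x ∈? p)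
∣p∣≡∑𝟙∈ []            = refl
∣p∣≡∑𝟙∈ (outside ∷ p) = ∣p∣≡∑𝟙∈ p
∣p∣≡∑𝟙∈ (inside ∷ p)  = cong suc (∣p∣≡∑𝟙∈ p)

∣p∪⁅x⁆∣≡1+∣p∣ : (p : Subset n) (x : Fin n) → x ∉ p → ∣ p ∪ ⁅ x ⁆ ∣ ≡ suc ∣ p ∣
∣p∪⁅x⁆∣≡1+∣p∣ (inside ∷ p)  zero    x∉p = contradiction here x∉p
∣p∪⁅x⁆∣≡1+∣p∣ (outside ∷ p) zero    x∉p = cong (suc ∘ ∣_∣) (∪-identityʳ p)
∣p∪⁅x⁆∣≡1+∣p∣ (inside ∷ p)  (suc x) x∉p = cong suc (∣p∪⁅x⁆∣≡1+∣p∣ p x (x∉p ∘ there))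
∣p∪⁅x⁆∣≡1+∣p∣ (outside ∷ p) (suc x) x∉p = ∣p∪⁅x⁆∣≡1+∣p∣ p x (x∉p ∘ there)

subsetOfSize : ∀ m (p : Subset n) → m ≤ ∣ p ∣ → ∃[ q ] q ⊆[ m ] p
subsetOfSize {n} zero p _ = ∅ , (λ x∈∅ → contradiction x∈∅ ∉⊥) , ∣⊥∣≡0 n
subsetOfSize (suc m) (outside ∷ p) m<∣p∣ with subsetOfSize (suc m) p m<∣p∣
... | q , q⊆p , ∣q∣≡1+m = outside ∷ q , out⊆ q⊆p , ∣q∣≡1+m
subsetOfSize (suc m) (inside ∷ p) (s≤s m≤∣p∣) with subsetOfSize m p m≤∣p∣
... | q , q⊆p , ∣q∣≡m = inside ∷ q , s⊆s q⊆p , cong suc ∣q∣≡m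

⁅x⁆⊆p⇔x∈p : {x : Fin n} {p : Subset n} → ⁅ x ⁆ ⊆ p ⇔ x ∈ p
⁅x⁆⊆p⇔x∈p {x = x} {p} = mk⇔
  (λ ⁅x⁆⊆p → ⁅x⁆⊆p (x∈⁅x⁆ x))
  (λ x∈p {y} y∈⁅x⁆ → subst (_∈ p) (sym (x∈⁅y⁆⇒x≡y x y∈⁅x⁆)) x∈p)

∈-tabulate⇔ : {f : Fin n → Bool} {x : Fin n} → x ∈ tabulate f ⇔ f x ≡ true
∈-tabulate⇔ {f = f} {x} = mk⇔
  (λ x∈ → trans (sym (lookup∘tabulate f x)) ([]=⇒lookup x∈))
  (λ fx → lookup⇒[]= x (tabulate f) (trans (lookup∘tabulate f x) fx))

⌊⌋≡true⇔ : (p : Dec A) → ⌊ p ⌋ ≡ true ⇔ A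
⌊⌋≡true⇔ (yes a) = mk⇔ (λ _ → a) (λ _ → refl)
⌊⌋≡true⇔ (no ¬a) = mk⇔ (λ ()) (λ a → contradiction a ¬a)

in-neighbours out-neighbours : Digraph n → Fin n → Subset n
in-neighbours  G w = commonIn G ⁅ w ⁆
out-neighbours G w = commonOut G ⁅ w ⁆

_⊢_⇉_ : Digraph n → Subset n → Subset n → Set
G ⊢ Q ⇉ Z = ∀ {q z} → q ∈ Q → z ∈ Z → arc G q z ≡ true

∈commonOut⇔ : ∀ (G : Digraph n) S {x} → x ∈ commonOut G S ⇔ (∀ {v} → v ∈ S → arc G v x ≡ true)
∈commonOut⇔ G S = mk⇔
  (λ x∈ {v} v∈S → to (⌊⌋≡true⇔ _) (to ∈-tabulate⇔ x∈) v v∈S)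
  (λ h → from ∈-tabulate⇔ (from (⌊⌋≡true⇔ _) (λ v v∈S → h v∈S)))

⊆commonOut⇔⇉ : ∀ {G : Digraph n} {Q Z} → Z ⊆ commonOut G Q ⇔ G ⊢ Q ⇉ Z
⊆commonOut⇔⇉ {G = G} {Q} = mk⇔
  (λ Z⊆ {q} {z} q∈Q z∈Z → to (∈commonOut⇔ G Q) (Z⊆ z∈Z) q∈Q)
  (λ Q⇉Z {z} z∈Z → from (∈commonOut⇔ G Q) (λ q∈Q → Q⇉Z q∈Q z∈Z))

-- commonIn G is definitionally commonOut (converse G), and converse (converse G) is G up to η,
-- so facts about in-neighbourhoods are the out-neighbourhood ones applied to converse G.
⊆commonIn⇔⇉ : ∀ {G : Digraph n} {Q Z} → Q ⊆ commonIn G Z ⇔ G ⊢ Q ⇉ Z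
⊆commonIn⇔⇉ {G = G} {Q} {Z} = mk⇔
  (λ Q⊆ {q} {z} q∈Q z∈Z → to (∈commonOut⇔ (converse G) Z) (Q⊆ q∈Q) z∈Z)
  (λ Q⇉Z {q} q∈Q → from (∈commonOut⇔ (converse G) Z) (λ z∈Z → Q⇉Z q∈Q z∈Z))

∈commonOut⇔⊆in-neighbours : ∀ (G : Digraph n) U w → w ∈ commonOut G U ⇔ U ⊆ in-neighbours G w
∈commonOut⇔⊆in-neighbours G U w = ⇔-trans (⇔-sym (⁅x⁆⊆p⇔x∈p {p = commonOut G U}))
  (⇔-trans (⊆commonOut⇔⇉ {G = G} {U}) (⇔-sym (⊆commonIn⇔⇉ {G = G} {U} {⁅ w ⁆})))

∉in-neighbours : w ∉ in-neighbours G w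
∉in-neighbours {w = w} {G = G} w∈ =
  case trans (sym (to (∈commonOut⇔ (converse G) ⁅ w ⁆) w∈ (x∈⁅x⁆ w))) (loopless G w) of λ ()

∣commonIn∣< : ∀ {G : Digraph n} {W} → IsLiking t l G → l < ∣ W ∣ → ∣ commonIn G W ∣ < t
∣commonIn∣< {t = t} {G = G} {W} liking l<∣W∣ = ≰⇒> λ t≤∣commonIn∣ →
  let U , U⊆commonIn , ∣U∣≡t = subsetOfSize t (commonIn G W) t≤∣commonIn∣
      W⊆commonOut = from (⊆commonOut⇔⇉ {G = G} {U} {W}) (to (⊆commonIn⇔⇉ {G = G}) U⊆commonIn)
  in <⇒≱ l<∣W∣ (≤-trans (p⊆q⇒∣p∣≤∣q∣ W⊆commonOut) (≤-reflexive (liking U ∣U∣≡t)))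

∣commonOut∣≡∑ : ∀ (G : Digraph n) U → ∣ commonOut G U ∣ ≡ ∑[ w < n ] 𝟙 (U ⊆? in-neighbours G w)
∣commonOut∣≡∑ G U = trans (∣p∣≡∑𝟙∈ (commonOut G U))
  (sum-cong-≗ λ w →
    𝟙-cong (∈commonOut⇔⊆in-neighbours G U w) (w ∈? commonOut G U) (U ⊆? in-neighbours G w))

∑ˢ-commonOut : ∀ (G : Digraph n) m →
  ∑ˢ[ U ] (𝟙 (∣ U ∣ ≟ m) * ∣ commonOut G U ∣) ≡ ∑[ w < n ] (∣ in-neighbours G w ∣ C m)
∑ˢ-commonOut {n} G m = begin
  ∑ˢ[ U ] (𝟙 (∣ U ∣ ≟ m) * ∣ commonOut G U ∣)
    ≡⟨ ∑ˢ-cong (λ U → cong (𝟙 (∣ U ∣ ≟ m) *_) (∣commonOut∣≡∑ G U)) ⟩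
  ∑ˢ[ U ] (𝟙 (∣ U ∣ ≟ m) * ∑[ w < n ] 𝟙 (U ⊆? in-neighbours G w))
    ≡⟨ ∑ˢ-cong (λ U → *-distribˡ-sum (𝟙 (∣ U ∣ ≟ m)) (λ w → 𝟙 (U ⊆? in-neighbours G w))) ⟩
  ∑ˢ[ U ] ∑[ w < n ] (𝟙 (∣ U ∣ ≟ m) * 𝟙 (U ⊆? in-neighbours G w))
    ≡⟨ ∑ˢ-cong (λ U → sum-cong-≗ λ w →
         trans (*-comm (𝟙 (∣ U ∣ ≟ m)) _) (sym (𝟙-× (U ⊆? in-neighbours G w) (∣ U ∣ ≟ m)))) ⟩
  ∑ˢ[ U ] ∑[ w < n ] 𝟙 (U ⊆[ m ]? in-neighbours G w)
    ≡⟨ ∑ˢ-∑-comm (λ U w → 𝟙 (U ⊆[ m ]? in-neighbours G w)) ⟩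
  ∑[ w < n ] ∑ˢ[ U ] 𝟙 (U ⊆[ m ]? in-neighbours G w)
    ≡⟨ sum-cong-≗ (λ w → ∑ˢ-𝟙-⊆[]≡C m (in-neighbours G w)) ⟩
  ∑[ w < n ] (∣ in-neighbours G w ∣ C m) ∎
  where open ≡-Reasoning

∣∪⁅w⁆∣≡1+m : ∀ {G : Digraph n} {w Q} → Q ⊆[ m ] in-neighbours G w → ∣ Q ∪ ⁅ w ⁆ ∣ ≡ suc m
∣∪⁅w⁆∣≡1+m {G = G} {w} {Q} (Q⊆ , ∣Q∣≡m) =
  trans (∣p∪⁅x⁆∣≡1+∣p∣ Q w (λ w∈Q → ∉in-neighbours {G = G} (Q⊆ w∈Q))) (cong suc ∣Q∣≡m)

Linked : Digraph n → ℕ → Fin n → Subset n → Subset n → Set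
Linked G m w Q Z = Q ⊆[ m ] in-neighbours G w × Z ⊆[ m ] commonOut G (Q ∪ ⁅ w ⁆)

linked? : ∀ (G : Digraph n) m w Q Z → Dec (Linked G m w Q Z)
linked? G m w Q Z = Q ⊆[ m ]? in-neighbours G w ×-dec Z ⊆[ m ]? commonOut G (Q ∪ ⁅ w ⁆)

Linked-converse : ∀ {G : Digraph n} {w Q Z} → Linked G m w Q Z → Linked (converse G) m w Z Q
Linked-converse {G = G} {w} {Q} {Z} ((Q⊆ , ∣Q∣≡m) , (Z⊆ , ∣Z∣≡m)) =
  (Z⊆out , ∣Z∣≡m) , (Q⊆commonIn , ∣Q∣≡m)
  where
  Q→w : G ⊢ Q ⇉ ⁅ w ⁆
  Q→w = to (⊆commonIn⇔⇉ {G = G}) Q⊆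
  Q∪w⇉Z : G ⊢ Q ∪ ⁅ w ⁆ ⇉ Z
  Q∪w⇉Z = to (⊆commonOut⇔⇉ {G = G} {Q ∪ ⁅ w ⁆}) Z⊆
  Z⊆out : Z ⊆ out-neighbours G w
  Z⊆out = from (⊆commonOut⇔⇉ {G = G} {⁅ w ⁆}) λ v∈⁅w⁆ → Q∪w⇉Z (x∈p∪q⁺ (inj₂ v∈⁅w⁆))
  Q⊆commonIn : Q ⊆ commonIn G (Z ∪ ⁅ w ⁆)
  Q⊆commonIn = from (⊆commonIn⇔⇉ {G = G}) λ q∈Q u∈Z∪w →
    [ Q∪w⇉Z (x∈p∪q⁺ (inj₁ q∈Q)) , Q→w q∈Q ] (x∈p∪q⁻ Z ⁅ w ⁆ u∈Z∪w)

∑ˢ-linked : ∀ (G : Digraph n) m w Q →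
  ∑ˢ[ Z ] 𝟙 (linked? G m w Q Z) ≡
  𝟙 (Q ⊆[ m ]? in-neighbours G w) * (∣ commonOut G (Q ∪ ⁅ w ⁆) ∣ C m)
∑ˢ-linked G m w Q = begin
  ∑ˢ[ Z ] 𝟙 (linked? G m w Q Z)
    ≡⟨ ∑ˢ-cong (λ Z → 𝟙-× (Q ⊆[ m ]? in-neighbours G w) (Z ⊆[ m ]? commonOut G (Q ∪ ⁅ w ⁆))) ⟩
  ∑ˢ[ Z ] (𝟙 (Q ⊆[ m ]? in-neighbours G w) * 𝟙 (Z ⊆[ m ]? commonOut G (Q ∪ ⁅ w ⁆)))
    ≡⟨ *-distribˡ-∑ˢ (𝟙 (Q ⊆[ m ]? in-neighbours G w))
                     (λ Z → 𝟙 (Z ⊆[ m ]? commonOut G (Q ∪ ⁅ w ⁆))) ⟨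
  𝟙 (Q ⊆[ m ]? in-neighbours G w) * ∑ˢ[ Z ] 𝟙 (Z ⊆[ m ]? commonOut G (Q ∪ ⁅ w ⁆))
    ≡⟨ cong (𝟙 (Q ⊆[ m ]? in-neighbours G w) *_) (∑ˢ-𝟙-⊆[]≡C m (commonOut G (Q ∪ ⁅ w ⁆))) ⟩
  𝟙 (Q ⊆[ m ]? in-neighbours G w) * (∣ commonOut G (Q ∪ ⁅ w ⁆) ∣ C m) ∎
  where open ≡-Reasoning

∑ˢ-in-neighbours≡∑ˢ-out-neighbours : ∀ (G : Digraph n) m w →
  ∑ˢ[ Q ] (𝟙 (Q ⊆[ m ]? in-neighbours G w) * (∣ commonOut G (Q ∪ ⁅ w ⁆) ∣ C m)) ≡
  ∑ˢ[ Z ] (𝟙 (Z ⊆[ m ]? out-neighbours G w) * (∣ commonIn G (Z ∪ ⁅ w ⁆) ∣ C m))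
∑ˢ-in-neighbours≡∑ˢ-out-neighbours G m w = begin
  ∑ˢ[ Q ] (𝟙 (Q ⊆[ m ]? in-neighbours G w) * (∣ commonOut G (Q ∪ ⁅ w ⁆) ∣ C m))
    ≡⟨ ∑ˢ-cong (λ Q → ∑ˢ-linked G m w Q) ⟨
  ∑ˢ[ Q ] ∑ˢ[ Z ] 𝟙 (linked? G m w Q Z)
    ≡⟨ ∑ˢ-comm (λ Q Z → 𝟙 (linked? G m w Q Z)) ⟩
  ∑ˢ[ Z ] ∑ˢ[ Q ] 𝟙 (linked? G m w Q Z)
    ≡⟨ ∑ˢ-cong (λ Z → ∑ˢ-cong λ Q →
         𝟙-cong (mk⇔ (Linked-converse {G = G}) (Linked-converse {G = converse G}))
                (linked? G m w Q Z) (linked? (converse G) m w Z Q)) ⟩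
  ∑ˢ[ Z ] ∑ˢ[ Q ] 𝟙 (linked? (converse G) m w Z Q)
    ≡⟨ ∑ˢ-cong (λ Z → ∑ˢ-linked (converse G) m w Z) ⟩
  ∑ˢ[ Z ] (𝟙 (Z ⊆[ m ]? out-neighbours G w) * (∣ commonIn G (Z ∪ ⁅ w ⁆) ∣ C m)) ∎
  where open ≡-Reasoning

in-degree-C≤out-degree-C : ∀ {G : Digraph n} → IsLiking (suc m) m G →
  ∀ w → ∣ in-neighbours G w ∣ C m ≤ ∣ out-neighbours G w ∣ C m
in-degree-C≤out-degree-C {m = m} {G = G} liking w = begin
  ∣ in-neighbours G w ∣ C m
    ≡⟨ ∑ˢ-𝟙-⊆[]≡C m (in-neighbours G w) ⟨
  ∑ˢ[ Q ] 𝟙 (Q ⊆[ m ]? in-neighbours G w)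
    ≡⟨ ∑ˢ-cong (λ Q → trans (sym (*-identityʳ (𝟙 (Q ⊆[ m ]? in-neighbours G w))))
                             (𝟙*-cong (Q ⊆[ m ]? in-neighbours G w) C∣commonOut∣≡1)) ⟩
  ∑ˢ[ Q ] (𝟙 (Q ⊆[ m ]? in-neighbours G w) * (∣ commonOut G (Q ∪ ⁅ w ⁆) ∣ C m))
    ≡⟨ ∑ˢ-in-neighbours≡∑ˢ-out-neighbours G m w ⟩
  ∑ˢ[ Z ] (𝟙 (Z ⊆[ m ]? out-neighbours G w) * (∣ commonIn G (Z ∪ ⁅ w ⁆) ∣ C m))
    ≤⟨ ∑ˢ-mono-≤ (λ Z → 𝟙*-mono-≤ (Z ⊆[ m ]? out-neighbours G w) C∣commonIn∣≤1) ⟩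
  ∑ˢ[ Z ] (𝟙 (Z ⊆[ m ]? out-neighbours G w) * 1)
    ≡⟨ ∑ˢ-cong (λ Z → *-identityʳ (𝟙 (Z ⊆[ m ]? out-neighbours G w))) ⟩
  ∑ˢ[ Z ] 𝟙 (Z ⊆[ m ]? out-neighbours G w)
    ≡⟨ ∑ˢ-𝟙-⊆[]≡C m (out-neighbours G w) ⟩
  ∣ out-neighbours G w ∣ C m ∎
  where
  open ≤-Reasoning

  C∣commonOut∣≡1 : ∀ {Q} → Q ⊆[ m ] in-neighbours G w → 1 ≡ ∣ commonOut G (Q ∪ ⁅ w ⁆) ∣ C m
  C∣commonOut∣≡1 {Q} Q⊆ =
    sym (trans (cong (_C m) (liking (Q ∪ ⁅ w ⁆) (∣∪⁅w⁆∣≡1+m {G = G} Q⊆))) (nCn≡1 m))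

  C∣commonIn∣≤1 : ∀ {Z} → Z ⊆[ m ] out-neighbours G w → ∣ commonIn G (Z ∪ ⁅ w ⁆) ∣ C m ≤ 1
  C∣commonIn∣≤1 Z⊆ = n≤k⇒nCk≤1 (≤-pred (∣commonIn∣< {G = G} liking
    (≤-reflexive (sym (∣∪⁅w⁆∣≡1+m {G = converse G} Z⊆)))))

∑ˢ-commonOut≤∑ˢ-commonIn : ∀ {G : Digraph n} → IsLiking (suc (suc k)) (suc k) G →
  ∑ˢ[ U ] (𝟙 (∣ U ∣ ≟ suc (suc k)) * ∣ commonOut G U ∣) ≤
  ∑ˢ[ U ] (𝟙 (∣ U ∣ ≟ suc (suc k)) * ∣ commonIn G U ∣)
∑ˢ-commonOut≤∑ˢ-commonIn {n} {k} {G} liking = begin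
  ∑ˢ[ U ] (𝟙 (∣ U ∣ ≟ suc (suc k)) * ∣ commonOut G U ∣)
    ≡⟨ ∑ˢ-commonOut G (suc (suc k)) ⟩
  ∑[ w < n ] (∣ in-neighbours G w ∣ C suc (suc k))
    ≤⟨ ∑-mono-≤ _ _ (λ w →
         mC[1+k]≤nC[1+k]⇒mC[2+k]≤nC[2+k] (∣ in-neighbours G w ∣) (∣ out-neighbours G w ∣) k
           (in-degree-C≤out-degree-C {G = G} liking w)) ⟩
  ∑[ w < n ] (∣ out-neighbours G w ∣ C suc (suc k))
    ≡⟨ ∑ˢ-commonOut (converse G) (suc (suc k)) ⟨
  ∑ˢ[ U ] (𝟙 (∣ U ∣ ≟ suc (suc k)) * ∣ commonIn G U ∣) ∎
  where open ≤-Reasoning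

∣commonIn∣≤∣commonOut∣ : ∀ {G : Digraph n} {U} → IsLiking (suc l) l G → ∣ U ∣ ≡ suc l →
  ∣ commonIn G U ∣ ≤ ∣ commonOut G U ∣
∣commonIn∣≤∣commonOut∣ {G = G} {U} liking ∣U∣≡1+l =
  ≤-trans (≤-pred (∣commonIn∣< {G = G} liking (≤-reflexive (sym ∣U∣≡1+l))))
          (≤-reflexive (sym (liking U ∣U∣≡1+l)))

proposition4p1 : (n l : ℕ) → .{{_ : NonZero l}} → (G : Digraph n) →
    IsLiking (suc l) l G → IsTwoWayLiking (suc l) l G
proposition4p1 n (suc k) G liking S ∣S∣≡2+k = liking S ∣S∣≡2+k , (begin
  ∣ commonIn G S ∣  ≡⟨ 𝟙*-cancel (∣ S ∣ ≟ suc (suc k)) ∣S∣≡2+k (squeeze S) ⟩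
  ∣ commonOut G S ∣ ≡⟨ liking S ∣S∣≡2+k ⟩
  suc k             ∎)
  where
  open ≡-Reasoning
  squeeze : ∀ U → 𝟙 (∣ U ∣ ≟ suc (suc k)) * ∣ commonIn G U ∣ ≡
                  𝟙 (∣ U ∣ ≟ suc (suc k)) * ∣ commonOut G U ∣
  squeeze = ∑ˢ-squeeze
    (λ U → 𝟙*-mono-≤ (∣ U ∣ ≟ suc (suc k)) (∣commonIn∣≤∣commonOut∣ {G = G} liking))
    (∑ˢ-commonOut≤∑ˢ-commonIn {G = G} liking)
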